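{- Let $G=(V,E)$ be a directed acyclic graph, let $\overline{G}$ be the complement of $G$ and $\overline{G^*}$ the complement of the transitive closure $G^*$ of $G$. If $H$ is a transitive orientation of $\overline{G}$, then $H\cap\overline{G^*}$ (the graph on $V$ whose edges are those edges of $H$ that are also edges of $\overline{G^*}$) is a transitive orientation of $\overline{G^*}$.
   Context: All graphs are simple and directed; an undirected edge is represented as a pair of opposite directed edges. For $G=(V,E)$, $E^{ -1}=\{(b,a)\mid (a,b)\in E\}$, and the complement of $G$ is the graph $(V,\{(a,b)\mid a,b\in V,\ a\neq b\}\setminus (E\cup E^{ -1}))$. A graph is transitive if $(a,b),(b,c)\in E$ with $a\neq c$ implies $(a,c)\in E$; the transitive closure $G^*=(V,E^*)$ has $E^*$ the minimal transitive superset of $E$. A graph $(V,E)$ is oriented if $E\cap E^{ -1}=\emptyset$; a graph $(V,E')$ is an orientation of $(V,E)$ if $E'$ is a maximal oriented subset of $E$. A transitive orientation is an orientation that is a transitive graph. -}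

module Defs where

open import Data.Nat using (ℕ)
open import Data.Fin using (Fin)
open import Data.Product using (_×_; Σ; _,_)
open import Data.Sum using (_⊎_)
open import Relation.Nullary using (¬_)
open import Relation.Binary.PropositionalEquality using (_≡_; _≢_)
open import Relation.Binary.Construct.Closure.Transitive using (TransClosure)

Rel : ℕ → Set₁
Rel n = Fin n → Fin n → Set

Simple : ∀ {n} → Rel n → Set
Simple E = ∀ a → ¬ E a a

_⊆_ : ∀ {n} → Rel n → Rel n → Set
E ⊆ F = ∀ a b → E a b → F a b

Inv : ∀ {n} → Rel n → Rel n
Inv E a b = E b a

Complement : ∀ {n} → Rel n → Rel n
Complement E a b = a ≢ b × ¬ (E a b ⊎ E b a)

_∩_ : ∀ {n} → Rel n → Rel n → Rel n
(E ∩ F) a b = E a b × F a b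

Transitive : ∀ {n} → Rel n → Set
Transitive E = ∀ a b c → E a b → E b c → a ≢ c → E a c

-- transitive closure E*: the least set containing E closed under the
-- rule of Transitive (inductive definition = minimal transitive superset)
data Closure {n} (E : Rel n) : Rel n where
  base : ∀ {a b} → E a b → Closure E a b
  step : ∀ {a b c} → Closure E a b → Closure E b c → a ≢ c → Closure E a c

Acyclic : ∀ {n} → Rel n → Set
Acyclic E = ∀ a → ¬ TransClosure E a a

Oriented : ∀ {n} → Rel n → Set
Oriented E = ∀ a b → E a b → ¬ E b a

IsOrientation : ∀ {n} → Rel n → Rel n → Set₁
IsOrientation {n} E′ E =
  (E′ ⊆ E) × Oriented E′ ×
  (∀ (F : Rel n) → E′ ⊆ F → F ⊆ E → Oriented F → F ⊆ E′)

IsTransitiveOrientation : ∀ {n} → Rel n → Rel n → Set₁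
IsTransitiveOrientation E′ E = IsOrientation E′ E × Transitive E′

module Submission where

-- Write K for the complement of the closure G* and H for the
-- given transitive orientation of the complement of G.  Since G ⊆ G*, K is a
-- symmetric subgraph of the complement of G, and restricting an orientation
-- of a loop-free graph to a symmetric subgraph yields an orientation of the
-- subgraph (maximality follows from the fact that an orientation contains
-- one direction of every edge).
-- For a H b H c with a, c distinct, transitivity of H gives a H c, and the
-- pair (a, c) is not an edge of G* by the key lemma: a transitive relation R
-- that orients the complement of G admits no G*-path x ⇝ y whose endpoints
-- are R-below and R-above a vertex b with x ⇝̸ b and b ⇝̸ y.  The lemma is
-- proved by induction on the derivation of the path, and it is applied both
-- to H (excluding a ⇝ c) and to its inverse (excluding c ⇝ a).

open import Data.Nat using (ℕ)
open import Data.Product using (_×_; _,_; proj₁; proj₂)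
open import Data.Sum using (_⊎_; inj₁; inj₂)
open import Data.Empty using (⊥)
open import Relation.Nullary using (¬_)
open import Relation.Binary.Definitions using (Symmetric)
open import Relation.Binary.PropositionalEquality using (_≡_; refl; sym)
open import Defs

complement-sym : ∀ {n} (E : Rel n) → Symmetric (Complement E)
complement-sym E (a≢b , ¬e) =
  (λ b≡a → a≢b (sym b≡a)) , λ { (inj₁ eba) → ¬e (inj₂ eba) ; (inj₂ eab) → ¬e (inj₁ eab) }

complement-simple : ∀ {n} (E : Rel n) → Simple (Complement E)
complement-simple E a (a≢a , _) = a≢a refl

complement-antitone : ∀ {n} {E F : Rel n} → E ⊆ F → Complement F ⊆ Complement E
complement-antitone E⊆F a b (a≢b , ¬f) =
  a≢b , λ { (inj₁ eab) → ¬f (inj₁ (E⊆F a b eab)) ; (inj₂ eba) → ¬f (inj₂ (E⊆F b a eba)) }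

closure-contains : ∀ {n} (E : Rel n) → E ⊆ Closure E
closure-contains E a b = base

Total : ∀ {n} → Rel n → Rel n → Set
Total R E = ∀ u v → E u v → ¬ R v u → R u v

-- An orientation of a loop-free graph is total: otherwise the edge (u, v)
-- could be added to it, contradicting maximality.
orientation-total : ∀ {n} {H E : Rel n} → Simple E → IsOrientation H E → Total H E
orientation-total {n} {H} {E} simple (H⊆E , oriented , maximal) u v euv ¬hvu =
  maximal F (λ _ _ → inj₁) F⊆E F-oriented u v (inj₂ (refl , refl))
  where
  F : Rel n
  F x y = H x y ⊎ (x ≡ u × y ≡ v)
  F⊆E : F ⊆ E
  F⊆E a b (inj₁ hab) = H⊆E a b hab
  F⊆E a b (inj₂ (refl , refl)) = euv
  F-oriented : Oriented F
  F-oriented a b (inj₁ hab) (inj₁ hba) = oriented a b hab hba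
  F-oriented a b (inj₁ hab) (inj₂ (refl , refl)) = ¬hvu hab
  F-oriented a b (inj₂ (refl , refl)) (inj₁ hba) = ¬hvu hba
  F-oriented a b (inj₂ (refl , refl)) (inj₂ (refl , _)) = simple a euv

restrict-orientation : ∀ {n} {H E K : Rel n} → Simple E → Symmetric K → K ⊆ E →
  IsOrientation H E → IsOrientation (H ∩ K) K
restrict-orientation {H = H} {K = K} simple K-sym K⊆E orientation@(_ , oriented , _) =
  (λ _ _ → proj₂) , (λ a b hkab hkba → oriented a b (proj₁ hkab) (proj₁ hkba)) , maximal
  where
  maximal : ∀ F → (H ∩ K) ⊆ F → F ⊆ K → Oriented F → F ⊆ (H ∩ K)
  maximal F HK⊆F F⊆K F-oriented a b fab =
    orientation-total simple orientation a b (K⊆E a b kab)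
      (λ hba → F-oriented a b fab (HK⊆F b a (hba , K-sym kab))) , kab
    where
    kab : K a b
    kab = F⊆K a b fab

-- Along a path
-- x ⇝ m ⇝ y, if b is G*-unrelated to x and y it is unrelated to m, so (m, b)
-- is an edge of the complement; R b m is excluded by induction on x ⇝ m, so
-- totality gives m R b, and induction on m ⇝ y finishes.  A single G-edge
-- x → y is impossible since x R y puts (x, y) in the complement of G.
module NoBypass {n} (G R : Rel n) (simple : Simple G)
  (R⊆∁G : R ⊆ Complement G) (R-trans : Transitive R) (R-total : Total R (Complement G))
  where

  no-bypass : ∀ {x y} b → Closure G x y → R x b → R b y →
    ¬ Closure G x b → ¬ Closure G b y → ⊥
  no-bypass b (base gxy) rxb rby _ _ =
    proj₂ (R⊆∁G _ _ (R-trans _ _ _ rxb rby (λ { refl → simple _ gxy }))) (inj₁ gxy)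
  no-bypass b (step {b = m} x⇝m m⇝y _) rxb rby x⇝̸b b⇝̸y =
    no-bypass b m⇝y rmb rby m⇝̸b b⇝̸y
    where
    m⇝̸b : ¬ Closure G m b
    m⇝̸b m⇝b = x⇝̸b (step x⇝m m⇝b (proj₁ (R⊆∁G _ _ rxb)))
    b⇝̸m : ¬ Closure G b m
    b⇝̸m b⇝m = b⇝̸y (step b⇝m m⇝y (proj₁ (R⊆∁G _ _ rby)))
    m∁b : Complement G m b
    m∁b = (λ { refl → x⇝̸b x⇝m }) , λ { (inj₁ gmb) → m⇝̸b (base gmb) ; (inj₂ gbm) → b⇝̸m (base gbm) }
    rmb : R m b
    rmb = R-total m b m∁b (λ rbm → no-bypass b x⇝m rxb rbm x⇝̸b b⇝̸m)

inv-sub-complement : ∀ {n} {G R : Rel n} → R ⊆ Complement G → Inv R ⊆ Complement G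
inv-sub-complement {G = G} R⊆∁G a b rba = complement-sym G (R⊆∁G b a rba)

inv-transitive : ∀ {n} {R : Rel n} → Transitive R → Transitive (Inv R)
inv-transitive R-trans a b c rba rcb a≢c = R-trans c b a rcb rba (λ c≡a → a≢c (sym c≡a))

inv-total : ∀ {n} {G R : Rel n} → Total R (Complement G) → Total (Inv R) (Complement G)
inv-total {G = G} R-total u v u∁v = R-total v u (complement-sym G u∁v)

restrict-transitive : ∀ {n} {G H : Rel n} → Simple G →
  H ⊆ Complement G → Transitive H → Total H (Complement G) →
  Transitive (H ∩ Complement (Closure G))
restrict-transitive {G = G} {H} simple H⊆∁G H-trans H-total a b c (hab , a∁b) (hbc , b∁c) a≢c =
  H-trans a b c hab hbc a≢c , a≢c , λ
    { (inj₁ a⇝c) → NoBypass.no-bypass G H simple H⊆∁G H-trans H-total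
        b a⇝c hab hbc (λ a⇝b → proj₂ a∁b (inj₁ a⇝b)) (λ b⇝c → proj₂ b∁c (inj₁ b⇝c))
    ; (inj₂ c⇝a) → NoBypass.no-bypass G (Inv H) simple
        (inv-sub-complement H⊆∁G) (inv-transitive H-trans) (inv-total H-total)
        b c⇝a hbc hab (λ c⇝b → proj₂ b∁c (inj₂ c⇝b)) (λ b⇝a → proj₂ a∁b (inj₂ b⇝a)) }

theorem8 : (n : ℕ) (G H : Rel n) → Simple G → Acyclic G →
    IsTransitiveOrientation H (Complement G) →
    IsTransitiveOrientation (H ∩ Complement (Closure G)) (Complement (Closure G))
theorem8 n G H simple _ (orientation@(H⊆∁G , _ , _) , H-trans) =
  restrict-orientation (complement-simple G) (complement-sym (Closure G))
    (complement-antitone (closure-contains G)) orientation ,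
  restrict-transitive simple H⊆∁G H-trans H-total
  where
  H-total : Total H (Complement G)
  H-total = orientation-total (complement-simple G) orientation
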